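{- Let $d,n$ be positive integers, let $C_d$ be the subgroup of order $d$ of a cyclic group $C_{dn}$ of order $dn$, let $\rho_d$ be the direct sum of all characters of $C_d$ of order $d$, and let $g=\gcd(n,d^\infty)$. Then $\operatorname{Ind}_{C_d}^{C_{dn}}\rho_d=\bigoplus_{n_1\mid n/g}\frac{g\varphi(d)}{\varphi(gd)}\rho_{dgn_1}$, where on the right $\rho_m$ denotes the direct sum of all characters of $C_{dn}$ of order $m$.
   Context: $\gcd(n,d^\infty)=\lim_{k\to\infty}\gcd(n,d^k)$; $\varphi$ is Euler's totient function; for rational $a$, $a\rho_m$ means $\rho_m^{\oplus a}$, i.e. a sum of $a\varphi(m)$ characters of order $m$ counted with multiplicity. -}

module Defs where

open import Data.Nat.Base
open import Data.Nat.Properties using (_≟_; m*n≢0)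
open import Data.Nat.GCD using (gcd; gcd[m,n]≢0)
open import Data.Nat.Divisibility using (_∣?_)
open import Data.Nat.DivMod using (_mod_)
open import Data.Fin.Base using (Fin; toℕ)
open import Data.List.Base using (List; upTo; map; filter; length)
open import Data.Nat.ListAction using (sum)
open import Data.Sum.Base using (inj₁; inj₂)
open import Data.Bool.Base using (if_then_else_)
open import Relation.Nullary.Decidable.Core using (does)
open import Relation.Binary.PropositionalEquality using (_≡_)

-- Euler's totient: φ m = #{ 0 ≤ k < m : gcd k m = 1 }  (so φ 1 = 1).
φ : ℕ → ℕ
φ m = length (filter (λ k → gcd k m ≟ 1) (upTo m))

-- gcd(n, d^∞) = lim_k gcd(n, d^k).  The sequence gcd(n,d^k) is
-- nondecreasing and bounded, and stabilises by k = n (every prime exponent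
-- of n is ≤ n), so the limit equals gcd(n, d^n).
gcdInf : ℕ → ℕ → ℕ
gcdInf n d = gcd n (d ^ n)

gcdInf-nonZero : ∀ n d → .{{NonZero n}} → NonZero (gcdInf n d)
gcdInf-nonZero n d = ≢-nonZero (gcd[m,n]≢0 n (d ^ n) (inj₁ (≢-nonZero⁻¹ n)))

-- The cyclic group C_N = ⟨γ⟩ of order N (N > 0).  Its characters are indexed
-- by k ∈ Fin N, character k sending γ ↦ exp(2πi k / N).
Char : ℕ → Set
Char N = Fin N

charOrder : (N : ℕ) → .{{NonZero N}} → Char N → ℕ
charOrder N k = _/_ N (gcd (toℕ k) N)
  {{≢-nonZero (gcd[m,n]≢0 (toℕ k) N (inj₂ (≢-nonZero⁻¹ N)))}}

-- A (complex, finite-dimensional) representation of the finite abelian group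
-- C_N, up to isomorphism, is determined by the multiplicity of each character.
Rep : ℕ → Set
Rep N = Char N → ℕ

ρ : (N : ℕ) → .{{NonZero N}} → ℕ → Rep N
ρ N m k = if does (charOrder N k ≟ m) then 1 else 0

infixl 6 _⊕_
_⊕_ : ∀ {N} → Rep N → Rep N → Rep N
(V ⊕ W) k = V k + W k

infixr 7 _·_
_·_ : ∀ {N} → ℕ → Rep N → Rep N
(a · V) k = a * V k

-- C_d ⊆ C_{dn} is the subgroup of order d, generated by γ^n.  Characters of
-- C_d are indexed by j ∈ Fin d, j sending γ^n ↦ exp(2πi j / d).
-- Restriction of character k of C_{dn} to C_d: γ^n ↦ exp(2πi k n/(dn)) =
-- exp(2πi k/d), i.e. the character (k mod d).
res : (d n : ℕ) → .{{NonZero d}} → Char (d * n) → Char d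
res d n k = toℕ k mod d

-- Induction from C_d to C_{dn}: by Frobenius reciprocity, the multiplicity of
-- the character ψ of C_{dn} in Ind V equals the multiplicity of Res ψ in V
-- (all groups abelian, all irreducibles are characters).
Ind : (d n : ℕ) → .{{NonZero d}} → Rep d → Rep (d * n)
Ind d n V ψ = V (res d n ψ)

⨁-divisors : ∀ {N} → ℕ → (ℕ → Rep N) → Rep N
⨁-divisors M F k = sum (map (λ n₁ → F n₁ k) (filter (λ n₁ → n₁ ∣? M) (map suc (upTo M))))

infix 4 _≅_
_≅_ : ∀ {N} → Rep N → Rep N → Set
V ≅ W = ∀ k → V k ≡ W k

{-# OPTIONS --safe #-}
-- A character ψ of C_{dn} restricts to
-- a character of order d of C_d exactly when gcd(ψ, d) = 1, so the left side is
-- φ(gd)·[gcd(ψ,d) = 1].  Write n = g m.  As g = gcd(n, d^∞), m is coprime to d while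
-- every prime factor of g divides d; hence φ(gd) = g φ(d), and for ψ coprime to d the
-- order of ψ is dn / gcd(ψ, m) = dg · (m / gcd(ψ, m)), that is dg n₁ for exactly one
-- divisor n₁ of m.  Conversely, if the order of ψ is dg n₁ then gcd(ψ, dn) divides m,
-- which forces gcd(ψ, d) = 1.
module Submission where

open import Defs
open import Data.Nat.Base using (ℕ; NonZero; _*_; _/_)
open import Data.Nat.Properties using (m*n≢0)

open import Data.Bool.Base using (Bool; true; false; if_then_else_)
open import Data.Fin.Base using (toℕ)
open import Data.Fin.Properties using (toℕ-fromℕ<)
open import Data.List.Base using ([]; _∷_; _++_; applyUpTo; upTo; map; filter; length)
open import Data.List.Properties using (map-∘; map-upTo)
open import Data.Nat.Base
open import Data.Nat.Properties
open import Data.Nat.Coprimality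
  using (Coprime; 1-coprimeTo; coprime-divisor; coprime⇒gcd≡1; gcd≡1⇒coprime)
  renaming (sym to coprime-sym)
open import Data.Nat.Divisibility
open import Data.Nat.DivMod
open import Data.Nat.GCD
open import Data.Nat.ListAction using (sum)
open import Data.Nat.ListAction.Properties using (sum-++)
open import Data.Product.Base using (_×_; _,_; ∃-syntax)
open import Data.Sum.Base using (_⊎_; inj₁; inj₂)
open import Function.Base using (_∘_)
open import Function.Bundles using (_⇔_; mk⇔)
open import Relation.Nullary.Decidable using (Dec; yes; no; does; dec-true; dec-false; does-⇔)
open import Relation.Nullary.Negation using (contradiction)
open import Relation.Unary using (Pred; Decidable)
open import Relation.Binary.PropositionalEquality

𝟙 : Bool → ℕ
𝟙 b = if b then 1 else 0

module _ {a p} {A : Set a} {P : Pred A p} (P? : Decidable P) where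

  length-filter≡sum-𝟙 : ∀ xs → length (filter P? xs) ≡ sum (map (λ x → 𝟙 (does (P? x))) xs)
  length-filter≡sum-𝟙 []       = refl
  length-filter≡sum-𝟙 (x ∷ xs) with does (P? x)
  ... | true  = cong suc (length-filter≡sum-𝟙 xs)
  ... | false = length-filter≡sum-𝟙 xs

  sum-map-filter : ∀ (f : A → ℕ) xs →
    sum (map f (filter P? xs)) ≡ sum (map (λ x → 𝟙 (does (P? x)) * f x) xs)
  sum-map-filter f []       = refl
  sum-map-filter f (x ∷ xs) with does (P? x)
  ... | true  = cong₂ _+_ (sym (+-identityʳ (f x))) (sum-map-filter f xs)
  ... | false = sum-map-filter f xs

applyUpTo-+ : ∀ {a} {A : Set a} (f : ℕ → A) m n →
  applyUpTo f (m + n) ≡ applyUpTo f m ++ applyUpTo (f ∘ (m +_)) n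
applyUpTo-+ f zero    n = refl
applyUpTo-+ f (suc m) n = cong (f 0 ∷_) (applyUpTo-+ (f ∘ suc) m n)

sumUpTo : (ℕ → ℕ) → ℕ → ℕ
sumUpTo f n = sum (applyUpTo f n)

sumUpTo-cong : ∀ {f g} n → (∀ i → f i ≡ g i) → sumUpTo f n ≡ sumUpTo g n
sumUpTo-cong zero    f≗g = refl
sumUpTo-cong (suc n) f≗g = cong₂ _+_ (f≗g 0) (sumUpTo-cong n (f≗g ∘ suc))

sumUpTo-+ : ∀ f m n → sumUpTo f (m + n) ≡ sumUpTo f m + sumUpTo (f ∘ (m +_)) n
sumUpTo-+ f m n = trans (cong sum (applyUpTo-+ f m n)) (sum-++ (applyUpTo f m) _)

sumUpTo-periodic : ∀ {f} p q → (∀ i → f (p + i) ≡ f i) → sumUpTo f (q * p) ≡ q * sumUpTo f p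
sumUpTo-periodic         p zero    periodic = refl
sumUpTo-periodic {f = f} p (suc q) periodic = begin
  sumUpTo f (p + q * p)                       ≡⟨ sumUpTo-+ f p (q * p) ⟩
  sumUpTo f p + sumUpTo (f ∘ (p +_)) (q * p)  ≡⟨ cong (sumUpTo f p +_) (sumUpTo-cong (q * p) periodic) ⟩
  sumUpTo f p + sumUpTo f (q * p)             ≡⟨ cong (sumUpTo f p +_) (sumUpTo-periodic p q periodic) ⟩
  sumUpTo f p + q * sumUpTo f p               ∎
  where open ≡-Reasoning

sumUpTo-zero : ∀ {f} n → (∀ i → f i ≡ 0) → sumUpTo f n ≡ 0
sumUpTo-zero zero    f≗0 = refl
sumUpTo-zero (suc n) f≗0 = cong₂ _+_ (f≗0 0) (sumUpTo-zero n (f≗0 ∘ suc))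

sumUpTo-single : ∀ {f n c} → c < n → (∀ i → i ≢ c → f i ≡ 0) → sumUpTo f n ≡ f c
sumUpTo-single {f} {suc n} {zero}  _         f≗0 =
  trans (cong (f 0 +_) (sumUpTo-zero n (λ i → f≗0 (suc i) λ ()))) (+-identityʳ (f 0))
sumUpTo-single {f} {suc n} {suc c} (s≤s c<n) f≗0 =
  cong₂ _+_ (f≗0 0 λ ()) (sumUpTo-single c<n (λ i i≢c → f≗0 (suc i) (i≢c ∘ suc-injective)))

φ≡sumUpTo : ∀ m → φ m ≡ sumUpTo (λ k → 𝟙 (does (gcd k m ≟ 1))) m
φ≡sumUpTo m = trans (length-filter≡sum-𝟙 (λ k → gcd k m ≟ 1) (upTo m)) (cong sum (map-upTo _ m))

⨁-divisors≡sumUpTo : ∀ {N} M (F : ℕ → Rep N) k →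
  ⨁-divisors M F k ≡ sumUpTo (λ i → 𝟙 (does (suc i ∣? M)) * F (suc i) k) M
⨁-divisors≡sumUpTo M F k = trans
  (sum-map-filter (_∣? M) (λ n₁ → F n₁ k) (map suc (upTo M)))
  (cong sum (trans (sym (map-∘ (upTo M))) (map-upTo _ M)))

⨁-divisors-zero : ∀ {N} M (F : ℕ → Rep N) k → (∀ n₁ → F n₁ k ≡ 0) → ⨁-divisors M F k ≡ 0
⨁-divisors-zero M F k F≗0 = trans (⨁-divisors≡sumUpTo M F k) (sumUpTo-zero M term≡0)
  where
  term≡0 : ∀ i → 𝟙 (does (suc i ∣? M)) * F (suc i) k ≡ 0
  term≡0 i = trans (cong (𝟙 (does (suc i ∣? M)) *_) (F≗0 (suc i))) (*-zeroʳ (𝟙 (does (suc i ∣? M))))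

⨁-divisors-single : ∀ {N M s} (F : ℕ → Rep N) k .{{_ : NonZero M}} → s ∣ M → s ≢ 0 →
  (∀ n₁ → n₁ ≢ s → F n₁ k ≡ 0) → ⨁-divisors M F k ≡ F s k
⨁-divisors-single {s = zero}  F k _   s≢0 _   = contradiction refl s≢0
⨁-divisors-single {M = M} {s = suc c} F k s∣M _ F≗0 = begin
  ⨁-divisors M F k                                       ≡⟨ ⨁-divisors≡sumUpTo M F k ⟩
  sumUpTo (λ i → 𝟙 (does (suc i ∣? M)) * F (suc i) k) M  ≡⟨ sumUpTo-single (∣⇒≤ s∣M) off-s ⟩
  𝟙 (does (suc c ∣? M)) * F (suc c) k                    ≡⟨ cong (λ b → 𝟙 b * F (suc c) k) s∣M? ⟩
  1 * F (suc c) k                                        ≡⟨ *-identityˡ _ ⟩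
  F (suc c) k                                            ∎
  where
  open ≡-Reasoning
  s∣M? : does (suc c ∣? M) ≡ true
  s∣M? = dec-true (suc c ∣? M) s∣M
  off-s : ∀ i → i ≢ c → 𝟙 (does (suc i ∣? M)) * F (suc i) k ≡ 0
  off-s i i≢c = trans (cong (𝟙 (does (suc i ∣? M)) *_) (F≗0 (suc i) (i≢c ∘ suc-injective)))
                      (*-zeroʳ (𝟙 (does (suc i ∣? M))))

gcd-nonZero : ∀ m n .{{_ : NonZero n}} → NonZero (gcd m n)
gcd-nonZero m n = ≢-nonZero (gcd[m,n]≢0 m n (inj₂ (≢-nonZero⁻¹ n)))

gcd[m+n,m]≡gcd[n,m] : ∀ m n → gcd (m + n) m ≡ gcd n m
gcd[m+n,m]≡gcd[n,m] m n = ∣-antisym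
  (gcd-greatest (∣m+n∣m⇒∣n (gcd[m,n]∣m (m + n) m) (gcd[m,n]∣n (m + n) m)) (gcd[m,n]∣n (m + n) m))
  (gcd-greatest (∣m∣n⇒∣m+n (gcd[m,n]∣n n m) (gcd[m,n]∣m n m)) (gcd[m,n]∣n n m))

gcd[m%n,n]≡gcd[m,n] : ∀ m n .{{_ : NonZero n}} → gcd (m % n) n ≡ gcd m n
gcd[m%n,n]≡gcd[m,n] m n = ∣-antisym
  (gcd-greatest (∣n∣m%n⇒∣m (gcd[m,n]∣n (m % n) n) (gcd[m,n]∣m (m % n) n)) (gcd[m,n]∣n (m % n) n))
  (gcd-greatest (%-presˡ-∣ (gcd[m,n]∣m m n) (gcd[m,n]∣n m n)) (gcd[m,n]∣n m n))

gcd[m,n*o]≡gcd[m,n*gcd[m,o]] : ∀ m n o → gcd m (n * o) ≡ gcd m (n * gcd m o)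
gcd[m,n*o]≡gcd[m,n*gcd[m,o]] m n o = ∣-antisym
  (gcd-greatest (gcd[m,n]∣m m (n * o))
    (subst (gcd m (n * o) ∣_) (sym (c*gcd[m,n]≡gcd[cm,cn] n m o))
      (gcd-greatest (∣-trans (gcd[m,n]∣m m (n * o)) (n∣m*n n)) (gcd[m,n]∣n m (n * o)))))
  (gcd-greatest (gcd[m,n]∣m m _) (∣-trans (gcd[m,n]∣n m _) (*-monoʳ-∣ n (gcd[m,n]∣n m o))))

coprime-∣ʳ : ∀ {k m n} → Coprime k m → n ∣ m → Coprime k n
coprime-∣ʳ k⊥m n∣m (i∣k , i∣n) = k⊥m (i∣k , ∣-trans i∣n n∣m)

coprime-* : ∀ {k m n} → Coprime k m → Coprime k n → Coprime k (m * n)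
coprime-* k⊥m k⊥n (i∣k , i∣mn) =
  k⊥n (i∣k , coprime-divisor (λ (j∣i , j∣m) → k⊥m (∣-trans j∣i i∣k , j∣m)) i∣mn)

coprime-^ : ∀ {k m} j → Coprime k m → Coprime k (m ^ j)
coprime-^ zero    _   = coprime-sym (1-coprimeTo _)
coprime-^ (suc j) k⊥m = coprime-* k⊥m (coprime-^ j k⊥m)

coprime⇒gcd[m,n*o]≡gcd[m,o] : ∀ {m n} o → Coprime m n → gcd m (n * o) ≡ gcd m o
coprime⇒gcd[m,n*o]≡gcd[m,o] {m} {n} o m⊥n = ∣-antisym
  (gcd-greatest (gcd[m,n]∣m m (n * o))
    (coprime-divisor (coprime-sym (coprime-∣ʳ (coprime-sym m⊥n) (gcd[m,n]∣m m (n * o))))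
      (gcd[m,n]∣n m (n * o))))
  (gcd-greatest (gcd[m,n]∣m m o) (∣n⇒∣m*n n (gcd[m,n]∣n m o)))

φ[m*n]≡m*φ[n] : ∀ {m n} → (∀ {k} → Coprime k n → Coprime k m) → φ (m * n) ≡ m * φ n
φ[m*n]≡m*φ[n] {m} {n} radical = begin
  φ (m * n)                            ≡⟨ φ≡sumUpTo (m * n) ⟩
  sumUpTo (coprimeTo (m * n)) (m * n)  ≡⟨ sumUpTo-cong (m * n) coprimeTo-m*n≗coprimeTo-n ⟩
  sumUpTo (coprimeTo n) (m * n)        ≡⟨ sumUpTo-periodic n m coprimeTo-n-periodic ⟩
  m * sumUpTo (coprimeTo n) n          ≡⟨ cong (m *_) (φ≡sumUpTo n) ⟨
  m * φ n                              ∎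
  where
  open ≡-Reasoning
  coprimeTo : ℕ → ℕ → ℕ
  coprimeTo j k = 𝟙 (does (gcd k j ≟ 1))
  to : ∀ k → gcd k (m * n) ≡ 1 → gcd k n ≡ 1
  to k gcd≡1 = coprime⇒gcd≡1 (coprime-∣ʳ (gcd≡1⇒coprime {k} {m * n} gcd≡1) (n∣m*n m))
  from : ∀ k → gcd k n ≡ 1 → gcd k (m * n) ≡ 1
  from k gcd≡1 = coprime⇒gcd≡1 (coprime-* (radical k⊥n) k⊥n)
    where
    k⊥n : Coprime k n
    k⊥n = gcd≡1⇒coprime gcd≡1
  coprimeTo-m*n≗coprimeTo-n : ∀ k → coprimeTo (m * n) k ≡ coprimeTo n k
  coprimeTo-m*n≗coprimeTo-n k =
    cong 𝟙 (does-⇔ (mk⇔ (to k) (from k)) (gcd k (m * n) ≟ 1) (gcd k n ≟ 1))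
  coprimeTo-n-periodic : ∀ k → coprimeTo n (n + k) ≡ coprimeTo n k
  coprimeTo-n-periodic k = cong (λ x → 𝟙 (does (x ≟ 1))) (gcd[m+n,m]≡gcd[n,m] n k)

module _ {f : ℕ → ℕ} (f-mono : ∀ j → f j ≤ f (suc j))
         (f-stays : ∀ j → f (suc j) ≡ f j → f (suc (suc j)) ≡ f (suc j)) where

  rises-or-stable : 0 < f 0 → ∀ j → j < f j ⊎ f (suc j) ≡ f j
  rises-or-stable f0>0 zero = inj₁ f0>0
  rises-or-stable f0>0 (suc j) with rises-or-stable f0>0 j
  ... | inj₂ stable = inj₂ (f-stays j stable)
  ... | inj₁ j<fj with f (suc j) ≟ f j
  ...   | yes stable   = inj₂ (f-stays j stable)
  ...   | no  unstable = inj₁ (≤-trans (s≤s j<fj) (≤∧≢⇒< (f-mono j) (unstable ∘ sym)))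

  stable-by-bound : 0 < f 0 → ∀ B → f B ≤ B → f (suc B) ≡ f B
  stable-by-bound f0>0 B fB≤B with rises-or-stable f0>0 B
  ... | inj₁ B<fB  = contradiction fB≤B (<⇒≱ B<fB)
  ... | inj₂ stable = stable

module _ (n d : ℕ) .{{_ : NonZero n}} where

  private instance
    g-nonZero : NonZero (gcdInf n d)
    g-nonZero = gcdInf-nonZero n d

  gcdInf∣n : gcdInf n d ∣ n
  gcdInf∣n = gcd[m,n]∣m n (d ^ n)

  gcdInf-stable : gcd n (d ^ suc n) ≡ gcdInf n d
  gcdInf-stable = stable-by-bound mono stays (≤-reflexive (sym (gcd-zeroʳ n))) n (∣⇒≤ gcdInf∣n)
    where
    G : ℕ → ℕ
    G j = gcd n (d ^ j)
    mono : ∀ j → G j ≤ G (suc j)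
    mono j = ∣⇒≤ {{≢-nonZero (gcd[m,n]≢0 n _ (inj₁ (≢-nonZero⁻¹ n)))}}
      (gcd-greatest (gcd[m,n]∣m n _) (∣-trans (gcd[m,n]∣n n _) (n∣m*n d)))
    stays : ∀ j → G (suc j) ≡ G j → G (suc (suc j)) ≡ G (suc j)
    stays j stable = begin
      gcd n (d * d ^ suc j) ≡⟨ gcd[m,n*o]≡gcd[m,n*gcd[m,o]] n d (d ^ suc j) ⟩
      gcd n (d * G (suc j)) ≡⟨ cong (λ x → gcd n (d * x)) stable ⟩
      gcd n (d * G j)       ≡⟨ gcd[m,n*o]≡gcd[m,n*gcd[m,o]] n d (d ^ j) ⟨
      G (suc j)             ∎
      where open ≡-Reasoning

  coprime[n/gcdInf,d] : Coprime (n / gcdInf n d) d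
  coprime[n/gcdInf,d] {i} (i∣n/g , i∣d) = ∣1⇒≡1 (*-cancelʳ-∣ g (subst (i * g ∣_) g≡1*g ig∣G))
    where
    g : ℕ
    g = gcdInf n d
    ig∣G : i * g ∣ gcd n (d ^ suc n)
    ig∣G = gcd-greatest (m∣n/o⇒m*o∣n gcdInf∣n i∣n/g) (*-pres-∣ i∣d (gcd[m,n]∣n n (d ^ n)))
    g≡1*g : gcd n (d ^ suc n) ≡ 1 * g
    g≡1*g = trans gcdInf-stable (sym (*-identityˡ g))

  coprime⇒coprime-gcdInf : ∀ {k} → Coprime k d → Coprime k (gcdInf n d)
  coprime⇒coprime-gcdInf k⊥d = coprime-∣ʳ (coprime-^ n k⊥d) (gcd[m,n]∣n n (d ^ n))

m/n≡m⇒n≡1 : ∀ {m n} .{{_ : NonZero m}} .{{_ : NonZero n}} → n ∣ m → m / n ≡ m → n ≡ 1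
m/n≡m⇒n≡1 {m} {n} n∣m m/n≡m = *-cancelˡ-≡ n 1 m (begin
  m * n     ≡⟨ cong (_* n) m/n≡m ⟨
  m / n * n ≡⟨ m/n*n≡m n∣m ⟩
  m         ≡⟨ *-identityʳ m ⟨
  m * 1     ∎)
  where open ≡-Reasoning

Ind-ρ≡𝟙[coprime] : ∀ d n .{{_ : NonZero d}} (k : Char (d * n)) →
  Ind d n (ρ d d) k ≡ 𝟙 (does (gcd (toℕ k) d ≟ 1))
Ind-ρ≡𝟙[coprime] d n k = begin
  𝟙 (does (charOrder d j ≟ d))
    ≡⟨ cong 𝟙 (does-⇔ full⇔coprime (charOrder d j ≟ d) (gcd (toℕ j) d ≟ 1)) ⟩
  𝟙 (does (gcd (toℕ j) d ≟ 1))
    ≡⟨ cong (λ x → 𝟙 (does (x ≟ 1))) gcd-res ⟩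
  𝟙 (does (gcd (toℕ k) d ≟ 1))
    ∎
  where
  open ≡-Reasoning
  j = res d n k
  instance
    gcd[j,d]-nonZero : NonZero (gcd (toℕ j) d)
    gcd[j,d]-nonZero = gcd-nonZero (toℕ j) d
  full⇔coprime : charOrder d j ≡ d ⇔ gcd (toℕ j) d ≡ 1
  full⇔coprime = mk⇔ (m/n≡m⇒n≡1 (gcd[m,n]∣n (toℕ j) d))
                     (λ gcd≡1 → trans (/-congʳ gcd≡1) (n/1≡n d))
  gcd-res : gcd (toℕ j) d ≡ gcd (toℕ k) d
  gcd-res = trans (cong (λ x → gcd x d) (toℕ-fromℕ< (m%n<n (toℕ k) d)))
                  (gcd[m%n,n]≡gcd[m,n] (toℕ k) d)

module _ (d n : ℕ) .{{_ : NonZero d}} .{{_ : NonZero n}} where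

  private
    g : ℕ
    g = gcdInf n d

    instance
      g-nonZero : NonZero g
      g-nonZero = gcdInf-nonZero n d

    m : ℕ
    m = n / g

    instance
      dn-nonZero : NonZero (d * n)
      dn-nonZero = m*n≢0 d n
      dg-nonZero : NonZero (d * g)
      dg-nonZero = m*n≢0 d g
      m-nonZero : NonZero m
      m-nonZero = ≢-nonZero (m/gcd[m,n]≢0 n (d ^ n) {{gcd≢0 = g-nonZero}})

    d*n≡d*g*m : d * n ≡ d * g * m
    d*n≡d*g*m = trans (cong (d *_) (sym (m*[n/m]≡n (gcdInf∣n n d)))) (sym (*-assoc d g m))

  charOrder-coprime : (k : Char (d * n)) → Coprime (toℕ k) d →
    ∃[ n₁ ] n₁ ∣ m × n₁ ≢ 0 × charOrder (d * n) k ≡ d * g * n₁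
  charOrder-coprime k K⊥d = m / gcd K m , m/n∣m (gcd[m,n]∣n K m) , n/gcd[m,n]≢0 K m , (begin
    d * n / gcd K (d * n)  ≡⟨ /-congʳ {m = d * n} gcd[K,dn]≡gcd[K,m] ⟩
    d * n / gcd K m        ≡⟨ /-congˡ {o = gcd K m} d*n≡d*g*m ⟩
    d * g * m / gcd K m    ≡⟨ *-/-assoc (d * g) (gcd[m,n]∣n K m) ⟩
    d * g * (m / gcd K m)  ∎)
    where
    open ≡-Reasoning
    K = toℕ k
    instance
      gcd[K,dn]-nonZero : NonZero (gcd K (d * n))
      gcd[K,dn]-nonZero = gcd-nonZero K (d * n)
      gcd[K,m]-nonZero : NonZero (gcd K m)
      gcd[K,m]-nonZero = gcd-nonZero K m
    gcd[K,dn]≡gcd[K,m] : gcd K (d * n) ≡ gcd K m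
    gcd[K,dn]≡gcd[K,m] = trans (cong (gcd K) d*n≡d*g*m)
      (coprime⇒gcd[m,n*o]≡gcd[m,o] m (coprime-* K⊥d (coprime⇒coprime-gcdInf n d K⊥d)))

  charOrder≡d*g*s⇒coprime : (k : Char (d * n)) {s : ℕ} → charOrder (d * n) k ≡ d * g * s →
    Coprime (toℕ k) d
  charOrder≡d*g*s⇒coprime k {s} order≡ {i} (i∣K , i∣d) =
    coprime[n/gcdInf,d] n d (∣-trans (gcd-greatest i∣K (∣m⇒∣m*n n i∣d)) h∣m , i∣d)
    where
    K = toℕ k
    h = gcd K (d * n)
    instance
      h-nonZero : NonZero h
      h-nonZero = gcd-nonZero K (d * n)
    h∣m : h ∣ m
    h∣m = divides s (*-cancelˡ-≡ m (s * h) (d * g) (begin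
      d * g * m          ≡⟨ d*n≡d*g*m ⟨
      d * n              ≡⟨ m/n*n≡m (gcd[m,n]∣n K (d * n)) ⟨
      d * n / h * h      ≡⟨ cong (_* h) order≡ ⟩
      d * g * s * h      ≡⟨ *-assoc (d * g) s h ⟩
      d * g * (s * h)    ∎))
      where open ≡-Reasoning

  ⨁-ρ≡𝟙[coprime] : (k : Char (d * n)) →
    ⨁-divisors m (λ n₁ → ρ (d * n) (d * g * n₁)) k ≡ 𝟙 (does (gcd (toℕ k) d ≟ 1))
  ⨁-ρ≡𝟙[coprime] k = by-coprimality (gcd (toℕ k) d ≟ 1)
    where
    F : ℕ → Rep (d * n)
    F n₁ = ρ (d * n) (d * g * n₁)
    -- The goal's `does (_ ≟ 1)` normalises to `_≡ᵇ 1`, which `with` cannot abstract.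
    by-coprimality : (K⊥d? : Dec (gcd (toℕ k) d ≡ 1)) → ⨁-divisors m F k ≡ 𝟙 (does K⊥d?)
    by-coprimality (no ¬K⊥d) = ⨁-divisors-zero m F k λ n₁ →
      cong 𝟙 (dec-false (charOrder (d * n) k ≟ d * g * n₁)
        (¬K⊥d ∘ coprime⇒gcd≡1 ∘ charOrder≡d*g*s⇒coprime k))
    by-coprimality (yes K⊥d) with charOrder-coprime k (gcd≡1⇒coprime K⊥d)
    ... | s , s∣m , s≢0 , order≡ =
      trans (⨁-divisors-single F k s∣m s≢0 off-s)
            (cong 𝟙 (dec-true (charOrder (d * n) k ≟ d * g * s) order≡))
      where
      off-s : ∀ n₁ → n₁ ≢ s → F n₁ k ≡ 0
      off-s n₁ n₁≢s = cong 𝟙 (dec-false (charOrder (d * n) k ≟ d * g * n₁)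
        (λ order≡′ → n₁≢s (*-cancelˡ-≡ n₁ s (d * g) (trans (sym order≡′) order≡))))

corollaryB5 : (d n : ℕ) → .{{_ : NonZero d}} → .{{_ : NonZero n}} →
    φ (gcdInf n d * d) · Ind d n (ρ d d) ≅
      (gcdInf n d * φ d) · ⨁-divisors {d * n} (_/_ n (gcdInf n d) {{gcdInf-nonZero n d}})
        (λ n₁ → ρ (d * n) {{m*n≢0 d n}} (d * gcdInf n d * n₁))
corollaryB5 d n k = begin
  φ (g * d) * Ind d n (ρ d d) k
    ≡⟨ cong₂ _*_ (φ[m*n]≡m*φ[n] (coprime⇒coprime-gcdInf n d)) (Ind-ρ≡𝟙[coprime] d n k) ⟩
  g * φ d * 𝟙 (does (gcd (toℕ k) d ≟ 1))
    ≡⟨ cong (g * φ d *_) (⨁-ρ≡𝟙[coprime] d n k) ⟨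
  g * φ d * ⨁-divisors (n / g) (λ n₁ → ρ (d * n) (d * g * n₁)) k
    ∎
  where
  open ≡-Reasoning
  g = gcdInf n d
  instance
    g-nonZero : NonZero g
    g-nonZero = gcdInf-nonZero n d
    dn-nonZero : NonZero (d * n)
    dn-nonZero = m*n≢0 d n
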